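{- Let $\mathcal{C}$ be a connected Stembridge crystal of type $A_{n-1}$ (weights normalized as in the context) and $\mathcal{Q}_{\mathcal{C}}$ its associated quasi-crystal structure. If $x\in\mathcal{C}$ and $i\in I$ satisfy $\ddot\varepsilon_i(x)=+\infty$, then $\mathrm{wt}_i(x)>0$ and $\mathrm{wt}_{i+1}(x)>0$.
   Context: Fix $n\ge2$, $I=\{1,\dots,n-1\}$, $\alpha_i=\mathbf{e}_i-\mathbf{e}_{i+1}\in\mathbb{Z}^n$, standard inner product. A crystal of type $A_{n-1}$ is a non-empty set $\mathcal{C}$ with maps $\widetilde e_i,\widetilde f_i:\mathcal{C}\to\mathcal{C}\sqcup\{\bot\}$, $\widetilde\varepsilon_i,\widetilde\varphi_i:\mathcal{C}\to\mathbb{Z}\sqcup\{ -\infty\}$, $\mathrm{wt}:\mathcal{C}\to\mathbb{Z}^n$ such that (C1) $\widetilde e_i(x)=y\iff x=\widetilde f_i(y)$, and then $\mathrm{wt}(y)=\mathrm{wt}(x)+\alpha_i$, $\widetilde\varepsilon_i(y)=\widetilde\varepsilon_i(x)-1$, $\widetilde\varphi_i(y)=\widetilde\varphi_i(x)+1$; (C2) $\widetilde\varphi_i(x)=\widetilde\varepsilon_i(x)+\langle\mathrm{wt}(x),\alpha_i\rangle$; (C3) if $\widetilde\varepsilon_i(x)=-\infty$ then $\widetilde e_i(x)=\widetilde f_i(x)=\bot$. Seminormal: $\widetilde\varepsilon_i(x)=\max\{k:\widetilde e_i^k(x)\ne\bot\}$, $\widetilde\varphi_i(x)=\max\{k:\widetilde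 f_i^k(x)\ne\bot\}$. A Stembridge crystal is a seminormal crystal satisfying Stembridge's axioms S1, S2, S2$'$, S3, S3$'$ for simply-laced type. Weight convention: weights in $\mathbb{Z}^n$ normalized so that the highest weight is a partition; in particular all $\mathrm{wt}(x)$ have non-negative entries; $\mathrm{wt}_k(x)$ is the $k$-th entry. The associated structure $\mathcal{Q}_{\mathcal{C}}$ has the same set and weights, with $\ddot\varepsilon_i(x)=\widetilde\varepsilon_i(x)$ if $\widetilde\varepsilon_i(x)=\mathrm{wt}_{i+1}(x)$ and $+\infty$ otherwise; $\ddot e_i(x)=\widetilde e_i(x)$ if $\widetilde\varepsilon_i(x)=\mathrm{wt}_{i+1}(x)$ and $\bot$ otherwise; $\ddot\varphi_i(x)=\ddot\varepsilon_i(x)+\langle\mathrm{wt}(x),\alpha_i\rangle$; $\ddot f_i(x)=y$ iff $\ddot e_i(y)=x$. -}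

module Defs where

open import Data.Nat using (ℕ; zero; suc)
import Data.Nat as ℕ
open import Data.Integer using (ℤ; +_; _+_; _-_; _*_; _≤_; _<_; 0ℤ; 1ℤ; -1ℤ)
import Data.Integer as ℤ
open import Data.Fin using (Fin; inject₁) renaming (zero to fzero; suc to fsuc)
import Data.Fin as Fin
open import Data.Maybe using (Maybe; just; nothing)
open import Data.List using (List; []; _∷_)
open import Data.Product using (Σ; ∃; _×_; _,_)
open import Relation.Binary.PropositionalEquality using (_≡_; _≢_)
open import Relation.Nullary using (yes; no)

-- Conventions: n = suc m.  Coordinates of ℤⁿ are indexed by Fin (suc m)
-- (paper's coordinate k ↔ Fin index k-1).  The index set I = {1,…,n-1}
-- is Fin m (paper's i ↔ Fin index i-1); hence paper's wt_i ↔ wt (inject₁ i)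
-- and paper's wt_{i+1} ↔ wt (fsuc i).

data ℤ∞ : Set where
  -∞  : ℤ∞
  fin : ℤ → ℤ∞

data ℤ± : Set where
  -∞' : ℤ±
  fin' : ℤ → ℤ±
  +∞  : ℤ±

infixl 6 _⊕_
_⊕_ : ℤ∞ → ℤ → ℤ∞
-∞    ⊕ k = -∞
fin a ⊕ k = fin (a + k)

infix 4 _≤∞_
data _≤∞_ : ℤ∞ → ℤ∞ → Set where
  -∞≤ : ∀ {a} → -∞ ≤∞ a
  fin≤ : ∀ {a b} → a ≤ b → fin a ≤∞ fin b

∑ : ∀ {n} → (Fin n → ℤ) → ℤ
∑ {zero}  v = 0ℤ
∑ {suc n} v = v fzero + ∑ (λ k → v (fsuc k))

⟨_,_⟩ : ∀ {n} → (Fin n → ℤ) → (Fin n → ℤ) → ℤ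
⟨ v , w ⟩ = ∑ (λ k → v k * w k)

𝐞 : ∀ {n} → Fin n → Fin n → ℤ
𝐞 k l with k Fin.≟ l
... | yes _ = 1ℤ
... | no  _ = 0ℤ

α : ∀ {m} → Fin m → Fin (suc m) → ℤ
α i k = 𝐞 (inject₁ i) k - 𝐞 (fsuc i) k

bind : ∀ {A : Set} → Maybe A → (A → Maybe A) → Maybe A
bind nothing  g = nothing
bind (just a) g = g a

Defined : ∀ {A : Set} → Maybe A → Set
Defined mx = ∃ λ y → mx ≡ just y

record Crystal (m : ℕ) : Set₁ where
  field
    Carrier  : Set
    element  : Carrier                                   -- non-empty
    e f      : Fin m → Carrier → Maybe Carrier           -- nothing = ⊥
    ε φ      : Fin m → Carrier → ℤ∞
    wt       : Carrier → Fin (suc m) → ℤ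
    C1-⇒     : ∀ i x y → e i x ≡ just y → f i y ≡ just x
    C1-⇐     : ∀ i x y → f i y ≡ just x → e i x ≡ just y
    C1-wt    : ∀ i x y → e i x ≡ just y → ∀ k → wt y k ≡ wt x k + α i k
    C1-ε     : ∀ i x y → e i x ≡ just y → ε i y ≡ ε i x ⊕ -1ℤ
    C1-φ     : ∀ i x y → e i x ≡ just y → φ i y ≡ φ i x ⊕ 1ℤ
    C2       : ∀ i x → φ i x ≡ ε i x ⊕ ⟨ wt x , α i ⟩
    C3-e     : ∀ i x → ε i x ≡ -∞ → e i x ≡ nothing
    C3-f     : ∀ i x → ε i x ≡ -∞ → f i x ≡ nothing

module _ {m : ℕ} (C : Crystal m) where
  open Crystal C

  eIter fIter : Fin m → ℕ → Carrier → Maybe Carrier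
  eIter i zero    x = just x
  eIter i (suc k) x = bind (eIter i k x) (e i)
  fIter i zero    x = just x
  fIter i (suc k) x = bind (fIter i k x) (f i)

  -- words of raising / lowering operators; the head of the list is applied first
  applyE applyF : List (Fin m) → Carrier → Maybe Carrier
  applyE []      x = just x
  applyE (i ∷ w) x = bind (e i x) (applyE w)
  applyF []      x = just x
  applyF (i ∷ w) x = bind (f i x) (applyF w)

  Seminormal : Set
  Seminormal =
    (∀ i x → Σ ℕ λ k → ε i x ≡ fin (+ k) × Defined (eIter i k x)
                        × (∀ k′ → Defined (eIter i k′ x) → k′ ℕ.≤ k))
    × (∀ i x → Σ ℕ λ k → φ i x ≡ fin (+ k) × Defined (fIter i k x)
                        × (∀ k′ → Defined (fIter i k′ x) → k′ ℕ.≤ k))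

  -- Stembridge's local axioms (simply-laced), with Stembridge's
  -- Δ_i δ(x,j) = ε_j(x) - ε_j(e_i x),  Δ_i φ(x,j) = φ_j(e_i x) - φ_j(x),
  -- ∇_i δ(y,j) = ε_j(f_i y) - ε_j(y),  ∇_i φ(y,j) = φ_j(y) - φ_j(f_i y).
  record IsStembridge : Set where
    field
      seminormal : Seminormal
      -- (S1)  Δ_i δ(x,j) ≤ 0 and Δ_i φ(x,j) ≤ 0
      S1-ε : ∀ i j x x₁ → i ≢ j → e i x ≡ just x₁ → ε j x ≤∞ ε j x₁
      S1-φ : ∀ i j x x₁ → i ≢ j → e i x ≡ just x₁ → φ j x₁ ≤∞ φ j x
      -- (S2)  Δ_i δ(x,j) = 0 ⇒ e_i e_j x = e_j e_i x = y and ∇_j φ(y,i) = 0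
      S2 : ∀ i j x x₁ x₂ → i ≢ j → e i x ≡ just x₁ → e j x ≡ just x₂
           → ε j x₁ ≡ ε j x
           → ∃ λ y → applyE (j ∷ i ∷ []) x ≡ just y × applyE (i ∷ j ∷ []) x ≡ just y
                    × (∀ z → f j y ≡ just z → φ i y ≡ φ i z)
      -- (S2′) ∇_i φ(x,j) = 0 ⇒ f_i f_j x = f_j f_i x = y and Δ_j δ(y,i) = 0
      S2′ : ∀ i j x x₁ x₂ → i ≢ j → f i x ≡ just x₁ → f j x ≡ just x₂
           → φ j x₁ ≡ φ j x
           → ∃ λ y → applyF (j ∷ i ∷ []) x ≡ just y × applyF (i ∷ j ∷ []) x ≡ just y
                    × (∀ z → e j y ≡ just z → ε i z ≡ ε i y)
      -- (S3)  Δ_i δ(x,j) = Δ_j δ(x,i) = -1 ⇒ e_i e_j² e_i x = e_j e_i² e_j x = y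
      --       and ∇_i φ(y,j) = ∇_j φ(y,i) = -1
      S3 : ∀ i j x x₁ x₂ → i ≢ j → e i x ≡ just x₁ → e j x ≡ just x₂
           → ε j x₁ ≡ ε j x ⊕ 1ℤ → ε i x₂ ≡ ε i x ⊕ 1ℤ
           → ∃ λ y → applyE (i ∷ j ∷ j ∷ i ∷ []) x ≡ just y
                    × applyE (j ∷ i ∷ i ∷ j ∷ []) x ≡ just y
                    × (∀ z → f i y ≡ just z → φ j z ≡ φ j y ⊕ 1ℤ)
                    × (∀ z → f j y ≡ just z → φ i z ≡ φ i y ⊕ 1ℤ)
      -- (S3′) ∇_i φ(x,j) = ∇_j φ(x,i) = -1 ⇒ f_i f_j² f_i x = f_j f_i² f_j x = y
      --       and Δ_i δ(y,j) = Δ_j δ(y,i) = -1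
      S3′ : ∀ i j x x₁ x₂ → i ≢ j → f i x ≡ just x₁ → f j x ≡ just x₂
           → φ j x₁ ≡ φ j x ⊕ 1ℤ → φ i x₂ ≡ φ i x ⊕ 1ℤ
           → ∃ λ y → applyF (i ∷ j ∷ j ∷ i ∷ []) x ≡ just y
                    × applyF (j ∷ i ∷ i ∷ j ∷ []) x ≡ just y
                    × (∀ z → e i y ≡ just z → ε j z ≡ ε j y ⊕ 1ℤ)
                    × (∀ z → e j y ≡ just z → ε i z ≡ ε i y ⊕ 1ℤ)

  data Path : Carrier → Carrier → Set where
    here : ∀ {x} → Path x x
    viaE : ∀ {x y z} i → e i x ≡ just y → Path y z → Path x z
    viaF : ∀ {x y z} i → f i x ≡ just y → Path y z → Path x z

  Connected : Set
  Connected = ∀ x y → Path x y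

  record WeightNormalized : Set where
    field
      highest      : Carrier
      highest-top  : ∀ i → e i highest ≡ nothing
      highest-part : ∀ (i : Fin m) → wt highest (fsuc i) ≤ wt highest (inject₁ i)
      nonneg       : ∀ x k → 0ℤ ≤ wt x k

  embed : ℤ∞ → ℤ±
  embed -∞      = -∞'
  embed (fin a) = fin' a

  ε̈ : Fin m → Carrier → ℤ±
  ε̈ i x with ε i x
  ... | -∞    = +∞
  ... | fin a with a ℤ.≟ wt x (fsuc i)
  ...   | yes _ = fin' a
  ...   | no  _ = +∞

  ë : Fin m → Carrier → Maybe Carrier
  ë i x with ε i x
  ... | -∞    = nothing
  ... | fin a with a ℤ.≟ wt x (fsuc i)
  ...   | yes _ = e i x
  ...   | no  _ = nothing

  φ̈ : Fin m → Carrier → ℤ±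
  φ̈ i x with ε̈ i x
  ... | -∞'    = -∞'
  ... | fin' a = fin' (a + ⟨ wt x , α i ⟩)
  ... | +∞     = +∞

{-# OPTIONS --safe #-}
-- Every application of ẽᵢ lowers the (i+1)-th weight coordinate by one, so as
-- weights are non-negative, εᵢ(x) ≤ wt_{i+1}(x).  The hypothesis ε̈ᵢ(x) = +∞
-- says that this inequality is strict, whence wt_{i+1}(x) > 0.  By (C2),
-- wt_i(x) = φᵢ(x) + (wt_{i+1}(x) − εᵢ(x)) > φᵢ(x) ≥ 0.
module Submission where

open import Defs
open import Data.Nat using (ℕ; zero; suc)
import Data.Nat as ℕ
import Data.Nat.Properties as ℕ
open import Data.Integer using (ℤ; +_; +≤+; 0ℤ; 1ℤ; -1ℤ; _+_; _-_; _*_; -_; _≤_; _<_)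
import Data.Integer.Properties as ℤ
open import Data.Integer.Tactic.RingSolver using (solve-∀)
open import Data.Fin using (Fin; inject₁; suc) renaming (zero to fzero)
import Data.Fin as Fin
import Data.Fin.Properties as Fin
open import Data.Maybe using (just)
open import Data.Product using (_×_; _,_; proj₁; proj₂)
open import Data.Empty using (⊥-elim)
open import Function using (_∘_)
open import Relation.Nullary using (yes; no)
open import Relation.Binary.PropositionalEquality

inject₁≢suc : ∀ {m} (i : Fin m) → inject₁ i ≢ suc i
inject₁≢suc i eq = ℕ.1+n≢n (sym (trans (sym (Fin.toℕ-inject₁ i)) (cong Fin.toℕ eq)))

𝐞-diagonal : ∀ {n} (k : Fin n) → 𝐞 k k ≡ 1ℤ
𝐞-diagonal k with k Fin.≟ k
... | yes _   = refl
... | no k≢k = ⊥-elim (k≢k refl)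

𝐞-offDiagonal : ∀ {n} {k l : Fin n} → k ≢ l → 𝐞 k l ≡ 0ℤ
𝐞-offDiagonal {k = k} {l} k≢l with k Fin.≟ l
... | yes k≡l = ⊥-elim (k≢l k≡l)
... | no _    = refl

𝐞-suc : ∀ {n} (k l : Fin n) → 𝐞 (suc k) (suc l) ≡ 𝐞 k l
𝐞-suc k l with k Fin.≟ l
... | yes _ = refl
... | no _  = refl

α-suc : ∀ {m} (i : Fin m) → α i (suc i) ≡ -1ℤ
α-suc i = cong₂ _-_ (𝐞-offDiagonal (inject₁≢suc i)) (𝐞-diagonal (suc i))

∑-cong : ∀ {n} {a b : Fin n → ℤ} → (∀ k → a k ≡ b k) → ∑ a ≡ ∑ b
∑-cong {zero}  _   = refl
∑-cong {suc n} a≗b = cong₂ _+_ (a≗b fzero) (∑-cong (a≗b ∘ suc))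

∑-zero : ∀ n → ∑ {n} (λ _ → 0ℤ) ≡ 0ℤ
∑-zero zero    = refl
∑-zero (suc n) = trans (ℤ.+-identityˡ _) (∑-zero n)

∑-distrib-- : ∀ {n} (a b : Fin n → ℤ) → ∑ (λ k → a k - b k) ≡ ∑ a - ∑ b
∑-distrib-- {zero}  a b = refl
∑-distrib-- {suc n} a b = begin
  a fzero - b fzero + ∑ (λ k → a (suc k) - b (suc k))
    ≡⟨ cong (_+_ (a fzero - b fzero)) (∑-distrib-- (a ∘ suc) (b ∘ suc)) ⟩
  a fzero - b fzero + (∑ (a ∘ suc) - ∑ (b ∘ suc))
    ≡⟨ +-minus-interchange (a fzero) (b fzero) (∑ (a ∘ suc)) (∑ (b ∘ suc)) ⟩
  a fzero + ∑ (a ∘ suc) - (b fzero + ∑ (b ∘ suc)) ∎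
  where
  open ≡-Reasoning
  +-minus-interchange : ∀ x y u v → x - y + (u - v) ≡ x + u - (y + v)
  +-minus-interchange = solve-∀

⟨-,𝐞⟩ : ∀ {n} (w : Fin n → ℤ) (j : Fin n) → ⟨ w , 𝐞 j ⟩ ≡ w j
⟨-,𝐞⟩ {suc n} w fzero = begin
  w fzero * 1ℤ + ∑ (λ k → w (suc k) * 0ℤ)
    ≡⟨ cong₂ _+_ (ℤ.*-identityʳ (w fzero)) (trans (∑-cong (ℤ.*-zeroʳ ∘ w ∘ suc)) (∑-zero n)) ⟩
  w fzero + 0ℤ
    ≡⟨ ℤ.+-identityʳ _ ⟩
  w fzero ∎
  where open ≡-Reasoning
⟨-,𝐞⟩ {suc n} w (suc j) = begin
  w fzero * 0ℤ + ∑ (λ k → w (suc k) * 𝐞 (suc j) (suc k))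
    ≡⟨ cong₂ _+_ (ℤ.*-zeroʳ (w fzero)) (∑-cong (λ k → cong (w (suc k) *_) (𝐞-suc j k))) ⟩
  0ℤ + ⟨ w ∘ suc , 𝐞 j ⟩
    ≡⟨ ℤ.+-identityˡ _ ⟩
  ⟨ w ∘ suc , 𝐞 j ⟩
    ≡⟨ ⟨-,𝐞⟩ (w ∘ suc) j ⟩
  w (suc j) ∎
  where open ≡-Reasoning

⟨-,α⟩ : ∀ {m} (w : Fin (suc m) → ℤ) (i : Fin m) → ⟨ w , α i ⟩ ≡ w (inject₁ i) - w (suc i)
⟨-,α⟩ w i = begin
  ∑ (λ k → w k * (𝐞 (inject₁ i) k - 𝐞 (suc i) k))
    ≡⟨ ∑-cong (λ k → *-distribˡ-minus (w k) (𝐞 (inject₁ i) k) (𝐞 (suc i) k)) ⟩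
  ∑ (λ k → w k * 𝐞 (inject₁ i) k - w k * 𝐞 (suc i) k)
    ≡⟨ ∑-distrib-- (λ k → w k * 𝐞 (inject₁ i) k) (λ k → w k * 𝐞 (suc i) k) ⟩
  ⟨ w , 𝐞 (inject₁ i) ⟩ - ⟨ w , 𝐞 (suc i) ⟩
    ≡⟨ cong₂ _-_ (⟨-,𝐞⟩ w (inject₁ i)) (⟨-,𝐞⟩ w (suc i)) ⟩
  w (inject₁ i) - w (suc i) ∎
  where
  open ≡-Reasoning
  *-distribˡ-minus : ∀ a b c → a * (b - c) ≡ a * b - a * c
  *-distribˡ-minus = solve-∀

k<j∧p≡k+[i-j]⇒0<i : ∀ {k p : ℕ} {i j : ℤ} → + k < j → + p ≡ + k + (i - j) → 0ℤ < i
k<j∧p≡k+[i-j]⇒0<i {k} {p} {i} {j} k<j p≡k+[i-j] = begin-strict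
  0ℤ                        ≡⟨ ℤ.+-inverseʳ (+ k) ⟨
  + k - + k                 <⟨ ℤ.+-monoˡ-< (- + k) k<j ⟩
  j - + k                   ≤⟨ ℤ.i≤j+i (j - + k) (+ p) ⟩
  + p + (j - + k)           ≡⟨ cong (_+ (j - + k)) p≡k+[i-j] ⟩
  + k + (i - j) + (j - + k) ≡⟨ telescope (+ k) i j ⟩
  i                         ∎
  where
  open ℤ.≤-Reasoning
  telescope : ∀ a b c → a + (b - c) + (c - a) ≡ b
  telescope = solve-∀

fin-injective : ∀ {a b} → fin a ≡ fin b → a ≡ b
fin-injective refl = refl

module _ {m : ℕ} (C : Crystal m) where
  open Crystal C

  eᵢ-lowers-wtᵢ₊₁ : ∀ {i x y} → e i x ≡ just y → wt y (suc i) + 1ℤ ≡ wt x (suc i)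
  eᵢ-lowers-wtᵢ₊₁ {i} {x} {y} eᵢx≡y = begin
    wt y (suc i) + 1ℤ               ≡⟨ cong (_+ 1ℤ) (C1-wt i x y eᵢx≡y (suc i)) ⟩
    wt x (suc i) + α i (suc i) + 1ℤ ≡⟨ cong (λ c → wt x (suc i) + c + 1ℤ) (α-suc i) ⟩
    wt x (suc i) + -1ℤ + 1ℤ         ≡⟨ ℤ.+-assoc (wt x (suc i)) -1ℤ 1ℤ ⟩
    wt x (suc i) + 0ℤ               ≡⟨ ℤ.+-identityʳ _ ⟩
    wt x (suc i)                    ∎
    where open ≡-Reasoning

  eIter-lowers-wtᵢ₊₁ : ∀ i k {x y} → eIter C i k x ≡ just y → wt y (suc i) + + k ≡ wt x (suc i)
  eIter-lowers-wtᵢ₊₁ i zero    refl = ℤ.+-identityʳ _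
  eIter-lowers-wtᵢ₊₁ i (suc k) {x} {y} eᵏ⁺¹x≡y with eIter C i k x in eᵏx≡y′
  ... | just y′ = begin
    wt y (suc i) + (1ℤ + + k) ≡⟨ ℤ.+-assoc (wt y (suc i)) 1ℤ (+ k) ⟨
    wt y (suc i) + 1ℤ + + k   ≡⟨ cong (_+ + k) (eᵢ-lowers-wtᵢ₊₁ eᵏ⁺¹x≡y) ⟩
    wt y′ (suc i) + + k       ≡⟨ eIter-lowers-wtᵢ₊₁ i k eᵏx≡y′ ⟩
    wt x (suc i)              ∎
    where open ≡-Reasoning

  eIter-length≤wtᵢ₊₁ : (∀ x k → 0ℤ ≤ wt x k) → ∀ {i k x}
                      → Defined (eIter C i k x) → + k ≤ wt x (suc i)
  eIter-length≤wtᵢ₊₁ nonneg {i} {k} (y , eᵏx≡y) =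
    subst (+ k ≤_) (eIter-lowers-wtᵢ₊₁ i k eᵏx≡y) (ℤ.+-monoˡ-≤ (+ k) (nonneg y (suc i)))

  ε̈≡+∞⇒ε≢wtᵢ₊₁ : ∀ {i x a} → ε̈ C i x ≡ +∞ → ε i x ≡ fin a → a ≢ wt x (suc i)
  ε̈≡+∞⇒ε≢wtᵢ₊₁ {i} {x} {a} ε̈≡+∞ εᵢx≡a a≡wt rewrite εᵢx≡a with a ℤ.≟ wt x (suc i)
  ... | yes _   = fin'≢+∞ ε̈≡+∞
    where
    fin'≢+∞ : fin' a ≢ +∞
    fin'≢+∞ ()
  ... | no a≢wt = a≢wt a≡wt

  φ≡ε⊕[wtᵢ-wtᵢ₊₁] : ∀ i x → φ i x ≡ ε i x ⊕ (wt x (inject₁ i) - wt x (suc i))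
  φ≡ε⊕[wtᵢ-wtᵢ₊₁] i x = trans (C2 i x) (cong (ε i x ⊕_) (⟨-,α⟩ (wt x) i))

lemma4p8 : (m : ℕ) → 1 ℕ.≤ m → (C : Crystal m)
    → IsStembridge C → Connected C → WeightNormalized C
    → (x : Crystal.Carrier C) (i : Fin m)
    → ε̈ C i x ≡ +∞
    → (0ℤ < Crystal.wt C x (inject₁ i)) × (0ℤ < Crystal.wt C x (suc i))
lemma4p8 m _ C stembridge _ normalized x i ε̈≡+∞
  with proj₁ (IsStembridge.seminormal stembridge) i x
     | proj₂ (IsStembridge.seminormal stembridge) i x
... | k , εᵢx≡k , eᵏx-defined , _ | p , φᵢx≡p , _ = 0<wtᵢ , 0<wtᵢ₊₁
  where
  open Crystal C
  open WeightNormalized normalized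

  k<wtᵢ₊₁ : + k < wt x (suc i)
  k<wtᵢ₊₁ = ℤ.≤∧≢⇒< (eIter-length≤wtᵢ₊₁ C nonneg eᵏx-defined)
                     (ε̈≡+∞⇒ε≢wtᵢ₊₁ C ε̈≡+∞ εᵢx≡k)

  0<wtᵢ₊₁ : 0ℤ < wt x (suc i)
  0<wtᵢ₊₁ = ℤ.≤-<-trans (+≤+ ℕ.z≤n) k<wtᵢ₊₁

  0<wtᵢ : 0ℤ < wt x (inject₁ i)
  0<wtᵢ = k<j∧p≡k+[i-j]⇒0<i k<wtᵢ₊₁ (fin-injective (begin
    fin (+ p)                                         ≡⟨ φᵢx≡p ⟨
    φ i x                                             ≡⟨ φ≡ε⊕[wtᵢ-wtᵢ₊₁] C i x ⟩
    ε i x ⊕ (wt x (inject₁ i) - wt x (suc i))         ≡⟨ cong (_⊕ _) εᵢx≡k ⟩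
    fin (+ k + (wt x (inject₁ i) - wt x (suc i)))     ∎))
    where open ≡-Reasoning
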